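{- Let $N$ and $r$ be integers with $r\ge 0$ and $2^r \le N < 2^{r+1}$. Then $$\frac{3N}{2} - \frac{r^2+7r+6}{4} \;\le\; \sum_{n=0}^{N-1} t(n) \;<\; \frac{3N}{2} - \frac12 .$$
   Context: The Stern sequence $(s(n))_{n\ge0}$ is defined by $s(0)=0$, $s(1)=1$, $s(2n)=s(n)$, $s(2n+1)=s(n)+s(n+1)$. It is known that $s(n+1)\ge1$ for all $n\ge0$. Define $t(n)=\frac{s(n)}{s(n+1)}$ for $n\ge 0$. -}

module Defs where

open import Data.Nat using (ℕ; zero; suc; _+_; _*_; _≤_; _<_; NonZero)
open import Data.Nat.Properties using (≤-trans)
open import Data.Bool using (Bool; true; false)
open import Data.Integer using (ℤ; +_)
open import Data.Rational using (ℚ; _/_)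
import Data.List
open import Data.List using (map; upTo)
import Data.Rational

half : ℕ → ℕ
half zero = zero
half (suc zero) = zero
half (suc (suc n)) = suc (half n)

odd? : ℕ → Bool
odd? zero = false
odd? (suc zero) = true
odd? (suc (suc n)) = odd? n

-- Stern sequence with a fuel argument, following the defining recurrence
--   s(0)=0, s(1)=1, s(2m)=s(m), s(2m+1)=s(m)+s(m+1).
-- Fuel f ≥ n is always enough.
sternF : ℕ → ℕ → ℕ
sternF _       zero          = 0
sternF _       (suc zero)    = 1
sternF zero    (suc (suc n)) = 0   -- unreachable when fuel ≥ n
sternF (suc f) (suc (suc n)) with odd? n
... | false = sternF f (suc (half n))                           -- n+2 = 2(h+1)
... | true  = sternF f (suc (half n)) + sternF f (suc (suc (half n)))  -- n+2 = 2(h+1)+1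

s : ℕ → ℕ
s n = sternF n n

open import Data.Nat using (z≤n; s≤s; s<s⁻¹; _≥_; >-nonZero; s≤s⁻¹)
open import Data.Nat.Properties using (≤-refl; m≤m+n; m≤n⇒m≤1+n)

half≤ : ∀ n → half n ≤ n
half≤ zero = z≤n
half≤ (suc zero) = z≤n
half≤ (suc (suc n)) = s≤s (m≤n⇒m≤1+n (half≤ n))

sternF-pos : ∀ f k → k ≤ f → 1 ≤ sternF f (suc k)
sternF-pos f zero _ = s≤s z≤n
sternF-pos (suc f) (suc n) (s≤s n≤f) with odd? n
... | false = sternF-pos f (half n) (≤-trans (half≤ n) n≤f)
... | true  = ≤-trans (sternF-pos f (half n) (≤-trans (half≤ n) n≤f)) (m≤m+n _ _)

s-suc-pos : ∀ n → 1 ≤ s (suc n)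
s-suc-pos n = sternF-pos (suc n) n (m≤n⇒m≤1+n ≤-refl)

s-suc-nonZero : ∀ n → NonZero (s (suc n))
s-suc-nonZero n = >-nonZero (s-suc-pos n)

t : ℕ → ℚ
t n = _/_ (+ s n) (s (suc n)) {{s-suc-nonZero n}}

sumT : ℕ → ℚ
sumT N = Data.List.foldr Data.Rational._+_ Data.Rational.0ℚ (map t (upTo N))

-- Let D(N) = Σ_{n<N} (3 − 2 t(n)), so that Σ_{n<N} t(n) = (3N − D(N))/2 and it suffices to show
-- 3 ≤ D(N) ≤ (r² + 7r + 6)/2.  Since t(2m+1) = t(m) + 1 and t(2m) = s(m)/(s(m) + s(m+1)),
-- pairing the terms 2m and 2m+1 gives
--   D(2K) = D(K) + G(K),   D(2K+1) = D(K) + G(K+1) + 2,   G(K) = Σ_{m<K} ψ(s(m), s(m+1)),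
-- with ψ(a, b) = (b − a)/(a + b).  The pairs (s(m), s(m+1)) with 2^k ≤ m < 2^(k+1) form level k
-- of the Calkin–Wilf tree, in which a/b has the children a/(a+b) and (a+b)/b, so
-- Σ_{m<2K} ψ(s(m), s(m+1)) = Σ_{m<K} ψ'(s(m), s(m+1)) with ψ'(a, b) = ψ(a, a+b) + ψ(a+b, b).
-- A weight ψ that is skew-symmetric and antitone in a/b passes both properties and its value at
-- (0, 1) on to ψ', and ψ(a, a+b) lies in [0, ψ(0, 1)]; hence 0 ≤ G(K) ≤ k whenever K < 2^k.
-- Induction on r, starting from D(1) = 3, then bounds D(N) for 2^r ≤ N < 2^(r+1) by B(r), where
-- B(0) = 3 and B(r+1) = B(r) + r + 4, i.e. 2 B(r) = r² + 7r + 6.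

module Submission where

open import Defs
open import Data.Nat as ℕ using (ℕ; _^_)
open import Data.Integer using (+_)
open import Data.Rational using (ℚ; _/_; _-_; _≤_; _<_)
import Data.Product

open import Algebra.Bundles using (CommutativeMonoid)
open import Data.Bool using (true; false)
open import Data.Integer as ℤ using ()
import Data.Integer.Properties as ℤₚ
open import Data.List using (foldr; map; applyUpTo)
open import Data.Nat using (zero; suc; z≤n; s≤s)
import Data.Nat.Properties as ℕₚ
open import Data.Nat.Tactic.RingSolver using (solve-∀)
open import Data.Product using (_×_; _,_; proj₁; proj₂)
open import Data.Rational as ℚ using (0ℚ; 1ℚ; ½; _+_; _*_; -_; 1/_; *≤*; *<*)
open import Data.Rational.Literals using (fromℤ)
import Data.Rational.Properties as ℚₚ
open import Data.Rational.Solver using (module +-*-Solver)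
import Data.Rational.Unnormalised as ℚᵘ
import Data.Rational.Unnormalised.Properties as ℚᵘₚ
open import Function using (_∘_; id)
open import Relation.Binary.PropositionalEquality

open import Algebra.Properties.CommutativeSemigroup
  (CommutativeMonoid.commutativeSemigroup ℚₚ.+-0-commutativeMonoid)
  using () renaming (interchange to +-interchange)

p≤p+q : ∀ p {q} → 0ℚ ≤ q → p ≤ p + q
p≤p+q p {q} 0≤q = subst (_≤ p + q) (ℚₚ.+-identityʳ p) (ℚₚ.+-monoʳ-≤ p 0≤q)

p≡-p⇒p≡0 : ∀ p → p ≡ - p → p ≡ 0ℚ
p≡-p⇒p≡0 p p≡-p = ℚₚ.toℚᵘ-injective (ℚᵘₚ.p≃-p⇒p≃0 (ℚ.toℚᵘ p)
  (ℚᵘₚ.≃-trans (ℚₚ.toℚᵘ-cong p≡-p) (ℚₚ.toℚᵘ-homo‿- p)))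

-- Via fromℤ rather than + n / 1, so that NonZero (fromℕ (suc n)) holds by computation.
fromℕ : ℕ → ℚ
fromℕ n = fromℤ (+ n)

fromℕ-suc : ∀ n → fromℕ (suc n) ≡ 1ℚ + fromℕ n
fromℕ-suc n = ℚₚ.toℚᵘ-injective (ℚᵘₚ.≃-sym (ℚᵘₚ.≃-trans (ℚₚ.toℚᵘ-homo-+ 1ℚ (fromℕ n))
  (ℚᵘ.*≡* (cong (λ i → (ℤ.1ℤ ℤ.+ i) ℤ.* ℤ.1ℤ) (ℤₚ.*-identityʳ (+ n))))))

fromℕ-+ : ∀ m n → fromℕ (m ℕ.+ n) ≡ fromℕ m + fromℕ n
fromℕ-+ zero    n = sym (ℚₚ.+-identityˡ (fromℕ n))
fromℕ-+ (suc m) n = begin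
  fromℕ (suc (m ℕ.+ n))           ≡⟨ fromℕ-suc (m ℕ.+ n) ⟩
  1ℚ + fromℕ (m ℕ.+ n)            ≡⟨ cong (_+_ 1ℚ) (fromℕ-+ m n) ⟩
  1ℚ + (fromℕ m + fromℕ n)        ≡⟨ ℚₚ.+-assoc 1ℚ (fromℕ m) (fromℕ n) ⟨
  (1ℚ + fromℕ m) + fromℕ n        ≡⟨ cong (_+ fromℕ n) (fromℕ-suc m) ⟨
  fromℕ (suc m) + fromℕ n         ∎
  where open ≡-Reasoning

fromℕ-* : ∀ m n → fromℕ (m ℕ.* n) ≡ fromℕ m * fromℕ n
fromℕ-* zero    n = sym (ℚₚ.*-zeroˡ (fromℕ n))
fromℕ-* (suc m) n = begin
  fromℕ (n ℕ.+ m ℕ.* n)           ≡⟨ fromℕ-+ n (m ℕ.* n) ⟩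
  fromℕ n + fromℕ (m ℕ.* n)       ≡⟨ cong (_+_ (fromℕ n)) (fromℕ-* m n) ⟩
  fromℕ n + fromℕ m * fromℕ n     ≡⟨ cong (_+ fromℕ m * fromℕ n) (ℚₚ.*-identityˡ (fromℕ n)) ⟨
  1ℚ * fromℕ n + fromℕ m * fromℕ n ≡⟨ ℚₚ.*-distribʳ-+ (fromℕ n) 1ℚ (fromℕ m) ⟨
  (1ℚ + fromℕ m) * fromℕ n        ≡⟨ cong (_* fromℕ n) (fromℕ-suc m) ⟨
  fromℕ (suc m) * fromℕ n         ∎
  where open ≡-Reasoning

fromℕ-suc-* : ∀ k c → fromℕ (suc k) * c ≡ fromℕ k * c + c
fromℕ-suc-* k c = trans (cong (_* c) (fromℕ-suc k))
  (solve 2 (λ k c → (con 1ℚ :+ k) :* c := k :* c :+ c) refl (fromℕ k) c)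
  where open +-*-Solver

fromℕ-mono-≤ : ∀ {m n} → m ℕ.≤ n → fromℕ m ≤ fromℕ n
fromℕ-mono-≤ m≤n = *≤* (ℤₚ.*-monoʳ-≤-nonNeg ℤ.1ℤ (ℤ.+≤+ m≤n))

+-mono-≤-fromℕ : ∀ {x y m n} → x ≤ fromℕ m → y ≤ fromℕ n → x + y ≤ fromℕ (m ℕ.+ n)
+-mono-≤-fromℕ {m = m} {n} x≤m y≤n = subst (_ ≤_) (sym (fromℕ-+ m n)) (ℚₚ.+-mono-≤ x≤m y≤n)

-- The value at b = 0 is junk.
ratio : ℕ → ℕ → ℚ
ratio a zero    = 0ℚ
ratio a (suc b) = + a / suc b

/≡ratio : ∀ a b .{{_ : ℕ.NonZero b}} → + a / b ≡ ratio a b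
/≡ratio a (suc b) = refl

ratio≡*1/ : ∀ a b → ratio a (suc b) ≡ fromℕ a * 1/ fromℕ (suc b)
ratio≡*1/ a b = ℚₚ.toℚᵘ-injective (ℚᵘₚ.≃-trans (ℚₚ.toℚᵘ-fromℚᵘ (ℚᵘ.mkℚᵘ (+ a) b))
  (ℚᵘₚ.≃-sym (ℚᵘₚ.≃-trans (ℚₚ.toℚᵘ-homo-* (fromℕ a) (1/ fromℕ (suc b)))
    (ℚᵘ.*≡* (cong₂ ℤ._*_ (ℤₚ.*-identityʳ (+ a)) (cong (+_ ∘ suc) (sym (ℕₚ.+-identityʳ b))))))))

ratio-+ : ∀ a b c → ratio a c + ratio b c ≡ ratio (a ℕ.+ b) c
ratio-+ a b zero    = refl
ratio-+ a b (suc c) = begin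
  ratio a (suc c) + ratio b (suc c)   ≡⟨ cong₂ _+_ (ratio≡*1/ a c) (ratio≡*1/ b c) ⟩
  fromℕ a * c⁻¹ + fromℕ b * c⁻¹       ≡⟨ ℚₚ.*-distribʳ-+ c⁻¹ (fromℕ a) (fromℕ b) ⟨
  (fromℕ a + fromℕ b) * c⁻¹           ≡⟨ cong (_* c⁻¹) (fromℕ-+ a b) ⟨
  fromℕ (a ℕ.+ b) * c⁻¹               ≡⟨ ratio≡*1/ (a ℕ.+ b) c ⟨
  ratio (a ℕ.+ b) (suc c)             ∎
  where
  open ≡-Reasoning
  c⁻¹ = 1/ fromℕ (suc c)

ratio-self : ∀ {c} → 0 ℕ.< c → ratio c c ≡ 1ℚ
ratio-self {suc c} _ = trans (ratio≡*1/ (suc c) c) (ℚₚ.*-inverseʳ (fromℕ (suc c)))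

ratio-mono : ∀ {a b c d} → 0 ℕ.< b → 0 ℕ.< d → a ℕ.* d ℕ.≤ c ℕ.* b → ratio a b ≤ ratio c d
ratio-mono {a} {suc b} {c} {suc d} _ _ ad≤cb = ℚₚ.toℚᵘ-cancel-≤
  (ℚᵘₚ.≤-respˡ-≃ (ℚᵘₚ.≃-sym (ℚₚ.toℚᵘ-fromℚᵘ (ℚᵘ.mkℚᵘ (+ a) b)))
  (ℚᵘₚ.≤-respʳ-≃ (ℚᵘₚ.≃-sym (ℚₚ.toℚᵘ-fromℚᵘ (ℚᵘ.mkℚᵘ (+ c) d)))
  (ℚᵘ.*≤* (subst₂ ℤ._≤_ (ℤₚ.pos-* a (suc d)) (ℤₚ.pos-* c (suc b)) (ℤ.+≤+ ad≤cb)))))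

∑ : ℕ → (ℕ → ℚ) → ℚ
∑ zero    f = 0ℚ
∑ (suc n) f = ∑ n f + f n

syntax ∑ n (λ i → e) = ∑[ i < n ] e

∑-cong : ∀ {f g} n → (∀ i → f i ≡ g i) → ∑ n f ≡ ∑ n g
∑-cong zero    f≡g = refl
∑-cong (suc n) f≡g = cong₂ _+_ (∑-cong n f≡g) (f≡g n)

∑-+ : ∀ n f g → ∑[ i < n ] (f i + g i) ≡ ∑ n f + ∑ n g
∑-+ zero    f g = refl
∑-+ (suc n) f g = trans (cong (_+ (f n + g n)) (∑-+ n f g)) (+-interchange (∑ n f) (∑ n g) (f n) (g n))

∑-pairs : ∀ n f → ∑ (2 ℕ.* n) f ≡ ∑[ i < n ] (f (2 ℕ.* i) + f (suc (2 ℕ.* i)))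
∑-pairs zero    f = refl
∑-pairs (suc n) f = begin
  ∑ (2 ℕ.* suc n) f                                 ≡⟨ cong (λ k → ∑ k f) (ℕₚ.*-suc 2 n) ⟩
  ∑ (2 ℕ.* n) f + f (2 ℕ.* n) + f (suc (2 ℕ.* n))   ≡⟨ ℚₚ.+-assoc (∑ (2 ℕ.* n) f) _ _ ⟩
  ∑ (2 ℕ.* n) f + (f (2 ℕ.* n) + f (suc (2 ℕ.* n)))
    ≡⟨ cong (_+ (f (2 ℕ.* n) + f (suc (2 ℕ.* n)))) (∑-pairs n f) ⟩
  ∑[ i < suc n ] (f (2 ℕ.* i) + f (suc (2 ℕ.* i)))  ∎
  where open ≡-Reasoning

∑-head : ∀ n f → ∑ (suc n) f ≡ f 0 + ∑ n (f ∘ suc)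
∑-head zero    f = trans (ℚₚ.+-identityˡ (f 0)) (sym (ℚₚ.+-identityʳ (f 0)))
∑-head (suc n) f = trans (cong (_+ f (suc n)) (∑-head n f)) (ℚₚ.+-assoc (f 0) _ _)

foldr-map-applyUpTo : ∀ {A : Set} (g : A → ℚ) f n → foldr _+_ 0ℚ (map g (applyUpTo f n)) ≡ ∑ n (g ∘ f)
foldr-map-applyUpTo g f zero    = refl
foldr-map-applyUpTo g f (suc n) =
  trans (cong (_+_ (g (f 0))) (foldr-map-applyUpTo g (f ∘ suc) n)) (sym (∑-head n (g ∘ f)))

-- The Stern sequence

data Parity : ℕ → Set where
  even : ∀ k → Parity (2 ℕ.* k)
  odd  : ∀ k → Parity (suc (2 ℕ.* k))

parity : ∀ n → Parity n
parity zero = even 0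
parity (suc n) with parity n
... | even k = odd k
... | odd k  = subst Parity (ℕₚ.*-suc 2 k) (even (suc k))

odd<double⇒< : ∀ {m n} → suc (2 ℕ.* m) ℕ.< 2 ℕ.* n → m ℕ.< n
odd<double⇒< {m} {n} 2m+1<2n = ℕₚ.*-cancelˡ-< 2 m n (ℕₚ.<-trans (ℕₚ.n<1+n (2 ℕ.* m)) 2m+1<2n)

double≤odd⇒≤ : ∀ {m n} → 2 ℕ.* m ℕ.≤ suc (2 ℕ.* n) → m ℕ.≤ n
double≤odd⇒≤ {m} {n} 2m≤2n+1 = ℕ.s≤s⁻¹ (ℕₚ.*-cancelˡ-< 2 m (suc n)
  (ℕₚ.≤-<-trans 2m≤2n+1 (subst (suc (2 ℕ.* n) ℕ.<_) (sym (ℕₚ.*-suc 2 n)) ℕₚ.≤-refl)))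

half-double : ∀ m → half (2 ℕ.* m) ≡ m
half-double zero    = refl
half-double (suc m) = trans (cong half (ℕₚ.*-suc 2 m)) (cong suc (half-double m))

half-double+1 : ∀ m → half (suc (2 ℕ.* m)) ≡ m
half-double+1 zero    = refl
half-double+1 (suc m) = trans (cong (half ∘ suc) (ℕₚ.*-suc 2 m)) (cong suc (half-double+1 m))

odd?-double : ∀ m → odd? (2 ℕ.* m) ≡ false
odd?-double zero    = refl
odd?-double (suc m) = trans (cong odd? (ℕₚ.*-suc 2 m)) (odd?-double m)

odd?-double+1 : ∀ m → odd? (suc (2 ℕ.* m)) ≡ true
odd?-double+1 zero    = refl
odd?-double+1 (suc m) = trans (cong (odd? ∘ suc) (ℕₚ.*-suc 2 m)) (odd?-double+1 m)

half<odd : ∀ n → odd? n ≡ true → half n ℕ.< n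
half<odd (suc zero)    _ = s≤s z≤n
half<odd (suc (suc n)) _ = s≤s (s≤s (half≤ n))

sternF-fuel : ∀ {f g} n → n ℕ.≤ f → n ℕ.≤ g → sternF f n ≡ sternF g n
sternF-fuel zero                _ _ = refl
sternF-fuel (suc zero)          _ _ = refl
sternF-fuel {suc f} {suc g} (suc (suc n)) (s≤s n<f) (s≤s n<g) with odd? n in n-odd
... | false = sternF-fuel _ (ℕₚ.≤-trans (s≤s (half≤ n)) n<f) (ℕₚ.≤-trans (s≤s (half≤ n)) n<g)
... | true  = cong₂ ℕ._+_
  (sternF-fuel _ (ℕₚ.≤-trans (s≤s (half≤ n)) n<f) (ℕₚ.≤-trans (s≤s (half≤ n)) n<g))
  (sternF-fuel _ (ℕₚ.≤-trans (s≤s (half<odd n n-odd)) n<f) (ℕₚ.≤-trans (s≤s (half<odd n n-odd)) n<g))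

s-step-even : ∀ n → odd? n ≡ false → s (suc (suc n)) ≡ s (suc (half n))
s-step-even n n-even rewrite n-even = sternF-fuel (suc (half n)) (s≤s (half≤ n)) ℕₚ.≤-refl

s-step-odd : ∀ n → odd? n ≡ true → s (suc (suc n)) ≡ s (suc (half n)) ℕ.+ s (suc (suc (half n)))
s-step-odd n n-odd rewrite n-odd = cong₂ ℕ._+_
  (sternF-fuel (suc (half n)) (s≤s (half≤ n)) ℕₚ.≤-refl)
  (sternF-fuel (suc (suc (half n))) (s≤s (half<odd n n-odd)) ℕₚ.≤-refl)

s-double : ∀ m → s (2 ℕ.* m) ≡ s m
s-double zero    = refl
s-double (suc m) = begin
  s (2 ℕ.* suc m)          ≡⟨ cong s (ℕₚ.*-suc 2 m) ⟩
  s (suc (suc (2 ℕ.* m)))  ≡⟨ s-step-even (2 ℕ.* m) (odd?-double m) ⟩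
  s (suc (half (2 ℕ.* m))) ≡⟨ cong (s ∘ suc) (half-double m) ⟩
  s (suc m)                ∎
  where open ≡-Reasoning

s-double+1 : ∀ m → s (suc (2 ℕ.* m)) ≡ s m ℕ.+ s (suc m)
s-double+1 zero    = refl
s-double+1 (suc m) = begin
  s (suc (2 ℕ.* suc m))                                        ≡⟨ cong (s ∘ suc) (ℕₚ.*-suc 2 m) ⟩
  s (suc (suc (suc (2 ℕ.* m))))                                ≡⟨ s-step-odd (suc (2 ℕ.* m)) (odd?-double+1 m) ⟩
  s (suc (half (suc (2 ℕ.* m)))) ℕ.+ s (suc (suc (half (suc (2 ℕ.* m)))))
    ≡⟨ cong (λ h → s (suc h) ℕ.+ s (suc (suc h))) (half-double+1 m) ⟩
  s (suc m) ℕ.+ s (suc (suc m))                                ∎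
  where open ≡-Reasoning

s-double+2 : ∀ m → s (suc (suc (2 ℕ.* m))) ≡ s (suc m)
s-double+2 m = trans (cong s (sym (ℕₚ.*-suc 2 m))) (s-double (suc m))

t≡ratio : ∀ n → t n ≡ ratio (s n) (s (suc n))
t≡ratio n = /≡ratio (s n) (s (suc n)) {{s-suc-nonZero n}}

t-double : ∀ m → t (2 ℕ.* m) ≡ ratio (s m) (s m ℕ.+ s (suc m))
t-double m = trans (t≡ratio (2 ℕ.* m)) (cong₂ ratio (s-double m) (s-double+1 m))

t-double+1 : ∀ m → t (suc (2 ℕ.* m)) ≡ t m + 1ℚ
t-double+1 m = begin
  t (suc (2 ℕ.* m))                                         ≡⟨ t≡ratio (suc (2 ℕ.* m)) ⟩
  ratio (s (suc (2 ℕ.* m))) (s (suc (suc (2 ℕ.* m))))      ≡⟨ cong₂ ratio (s-double+1 m) (s-double+2 m) ⟩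
  ratio (s m ℕ.+ s (suc m)) (s (suc m))                     ≡⟨ ratio-+ (s m) (s (suc m)) (s (suc m)) ⟨
  ratio (s m) (s (suc m)) + ratio (s (suc m)) (s (suc m))
    ≡⟨ cong₂ _+_ (sym (t≡ratio m)) (ratio-self (s-suc-pos m)) ⟩
  t m + 1ℚ                                                  ∎
  where open ≡-Reasoning

sumT≡∑ : ∀ N → sumT N ≡ ∑ N t
sumT≡∑ = foldr-map-applyUpTo t id

-- Sums along the Calkin–Wilf tree

RatioAntitone : (ℕ → ℕ → ℚ) → Set
RatioAntitone ψ = ∀ a b c d → 0 ℕ.< b → 0 ℕ.< d → a ℕ.* d ℕ.≤ c ℕ.* b → ψ c d ≤ ψ a b

SkewSymmetric : (ℕ → ℕ → ℚ) → Set
SkewSymmetric ψ = ∀ a b → 0 ℕ.< a → 0 ℕ.< b → ψ b a ≡ - ψ a b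

childSum : (ℕ → ℕ → ℚ) → ℕ → ℕ → ℚ
childSum ψ a b = ψ a (a ℕ.+ b) + ψ (a ℕ.+ b) b

cross-≤-leftChild : ∀ a b c d → a ℕ.* d ℕ.≤ c ℕ.* b → a ℕ.* (c ℕ.+ d) ℕ.≤ c ℕ.* (a ℕ.+ b)
cross-≤-leftChild a b c d ad≤cb = begin
  a ℕ.* (c ℕ.+ d)       ≡⟨ ℕₚ.*-distribˡ-+ a c d ⟩
  a ℕ.* c ℕ.+ a ℕ.* d   ≤⟨ ℕₚ.+-mono-≤ (ℕₚ.≤-reflexive (ℕₚ.*-comm a c)) ad≤cb ⟩
  c ℕ.* a ℕ.+ c ℕ.* b   ≡⟨ ℕₚ.*-distribˡ-+ c a b ⟨
  c ℕ.* (a ℕ.+ b)       ∎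
  where open ℕₚ.≤-Reasoning

cross-≤-rightChild : ∀ a b c d → a ℕ.* d ℕ.≤ c ℕ.* b → (a ℕ.+ b) ℕ.* d ℕ.≤ (c ℕ.+ d) ℕ.* b
cross-≤-rightChild a b c d ad≤cb = begin
  (a ℕ.+ b) ℕ.* d       ≡⟨ ℕₚ.*-distribʳ-+ d a b ⟩
  a ℕ.* d ℕ.+ b ℕ.* d   ≤⟨ ℕₚ.+-mono-≤ ad≤cb (ℕₚ.≤-reflexive (ℕₚ.*-comm b d)) ⟩
  c ℕ.* b ℕ.+ d ℕ.* b   ≡⟨ ℕₚ.*-distribʳ-+ b c d ⟨
  (c ℕ.+ d) ℕ.* b       ∎
  where open ℕₚ.≤-Reasoning

childSum-antitone : ∀ {ψ} → RatioAntitone ψ → RatioAntitone (childSum ψ)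
childSum-antitone ψ-anti a b c d 0<b 0<d ad≤cb = ℚₚ.+-mono-≤
  (ψ-anti a (a ℕ.+ b) c (c ℕ.+ d) (ℕₚ.<-≤-trans 0<b (ℕₚ.m≤n+m b a)) (ℕₚ.<-≤-trans 0<d (ℕₚ.m≤n+m d c))
    (cross-≤-leftChild a b c d ad≤cb))
  (ψ-anti (a ℕ.+ b) b (c ℕ.+ d) d 0<b 0<d (cross-≤-rightChild a b c d ad≤cb))

childSum-skew : ∀ {ψ} → SkewSymmetric ψ → SkewSymmetric (childSum ψ)
childSum-skew {ψ} ψ-skew a b 0<a 0<b = begin
  ψ b (b ℕ.+ a) + ψ (b ℕ.+ a) a       ≡⟨ cong (λ n → ψ b n + ψ n a) (ℕₚ.+-comm b a) ⟩
  ψ b (a ℕ.+ b) + ψ (a ℕ.+ b) a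
    ≡⟨ cong₂ _+_ (ψ-skew (a ℕ.+ b) b 0<a+b 0<b) (ψ-skew a (a ℕ.+ b) 0<a 0<a+b) ⟩
  - ψ (a ℕ.+ b) b + - ψ a (a ℕ.+ b)   ≡⟨ ℚₚ.+-comm (- ψ (a ℕ.+ b) b) (- ψ a (a ℕ.+ b)) ⟩
  - ψ a (a ℕ.+ b) + - ψ (a ℕ.+ b) b   ≡⟨ ℚₚ.neg-distrib-+ (ψ a (a ℕ.+ b)) (ψ (a ℕ.+ b) b) ⟨
  - childSum ψ a b                    ∎
  where
  open ≡-Reasoning
  0<a+b = ℕₚ.<-≤-trans 0<a (ℕₚ.m≤m+n a b)

skew-diagonal : ∀ {ψ} → SkewSymmetric ψ → ψ 1 1 ≡ 0ℚ
skew-diagonal {ψ} ψ-skew = p≡-p⇒p≡0 (ψ 1 1) (ψ-skew 1 1 ℕₚ.≤-refl ℕₚ.≤-refl)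

childSum-0-1 : ∀ {ψ} → SkewSymmetric ψ → childSum ψ 0 1 ≡ ψ 0 1
childSum-0-1 {ψ} ψ-skew = trans (cong (_+_ (ψ 0 1)) (skew-diagonal ψ-skew)) (ℚₚ.+-identityʳ (ψ 0 1))

antitone-skew-nonNeg : ∀ {ψ} → RatioAntitone ψ → SkewSymmetric ψ →
                       ∀ {a b} → a ℕ.≤ b → 0 ℕ.< b → 0ℚ ≤ ψ a b
antitone-skew-nonNeg {ψ} ψ-anti ψ-skew {a} {b} a≤b 0<b = subst (_≤ ψ a b) (skew-diagonal ψ-skew)
  (ψ-anti a b 1 1 0<b ℕₚ.≤-refl (subst₂ ℕ._≤_ (sym (ℕₚ.*-identityʳ a)) (sym (ℕₚ.*-identityˡ b)) a≤b))

antitone-≤-ψ01 : ∀ {ψ} → RatioAntitone ψ → ∀ {a b} → 0 ℕ.< b → ψ a b ≤ ψ 0 1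
antitone-≤-ψ01 ψ-anti {a} {b} 0<b = ψ-anti 0 1 a b ℕₚ.≤-refl 0<b z≤n

sternSum : (ℕ → ℕ → ℚ) → ℕ → ℚ
sternSum ψ M = ∑[ m < M ] ψ (s m) (s (suc m))

sternSum-double : ∀ ψ K → sternSum ψ (2 ℕ.* K) ≡ sternSum (childSum ψ) K
sternSum-double ψ K = trans (∑-pairs K _) (∑-cong K λ m →
  cong₂ _+_ (cong₂ ψ (s-double m) (s-double+1 m)) (cong₂ ψ (s-double+1 m) (s-double+2 m)))

sternSum-double+1 : ∀ ψ K →
  sternSum ψ (suc (2 ℕ.* K)) ≡ sternSum (childSum ψ) K + ψ (s K) (s K ℕ.+ s (suc K))
sternSum-double+1 ψ K = cong₂ _+_ (sternSum-double ψ K) (cong₂ ψ (s-double K) (s-double+1 K))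

sternSum-bounds : ∀ {ψ} → RatioAntitone ψ → SkewSymmetric ψ → ∀ k {M} → M ℕ.< 2 ^ k →
                  0ℚ ≤ sternSum ψ M × sternSum ψ M ≤ fromℕ k * ψ 0 1
sternSum-bounds {ψ} ψ-anti ψ-skew zero {zero} _ =
  ℚₚ.≤-refl , ℚₚ.≤-reflexive (sym (ℚₚ.*-zeroˡ (ψ 0 1)))
sternSum-bounds ψ-anti ψ-skew zero {suc M} (s≤s ())
sternSum-bounds {ψ} ψ-anti ψ-skew (suc k) {M} = split (parity M)
  where
  open ℚₚ.≤-Reasoning
  c = ψ 0 1
  0≤c : 0ℚ ≤ c
  0≤c = antitone-skew-nonNeg ψ-anti ψ-skew z≤n ℕₚ.≤-refl
  children-bounds : ∀ K → K ℕ.< 2 ^ k →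
                    0ℚ ≤ sternSum (childSum ψ) K × sternSum (childSum ψ) K ≤ fromℕ k * childSum ψ 0 1
  children-bounds K = sternSum-bounds (childSum-antitone ψ-anti) (childSum-skew ψ-skew) k {K}
  split : ∀ {M} → Parity M → M ℕ.< 2 ^ suc k → 0ℚ ≤ sternSum ψ M × sternSum ψ M ≤ fromℕ (suc k) * c
  split (even K) 2K<2^[1+k] =
    subst (0ℚ ≤_) (sym (sternSum-double ψ K)) (proj₁ K-bounds) , (begin
      sternSum ψ (2 ℕ.* K)        ≡⟨ sternSum-double ψ K ⟩
      sternSum (childSum ψ) K     ≤⟨ proj₂ K-bounds ⟩
      fromℕ k * childSum ψ 0 1    ≡⟨ cong (fromℕ k *_) (childSum-0-1 ψ-skew) ⟩
      fromℕ k * c                 ≤⟨ p≤p+q (fromℕ k * c) 0≤c ⟩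
      fromℕ k * c + c             ≡⟨ fromℕ-suc-* k c ⟨
      fromℕ (suc k) * c           ∎)
    where K-bounds = children-bounds K (ℕₚ.*-cancelˡ-< 2 K (2 ^ k) 2K<2^[1+k])
  split (odd K) 2K+1<2^[1+k] =
    subst (0ℚ ≤_) (sym (sternSum-double+1 ψ K))
      (ℚₚ.+-mono-≤ (proj₁ K-bounds) (antitone-skew-nonNeg ψ-anti ψ-skew (ℕₚ.m≤m+n (s K) (s (suc K))) 0<b)) ,
    (begin
      sternSum ψ (suc (2 ℕ.* K))
        ≡⟨ sternSum-double+1 ψ K ⟩
      sternSum (childSum ψ) K + ψ (s K) (s K ℕ.+ s (suc K))
        ≤⟨ ℚₚ.+-mono-≤ (proj₂ K-bounds) (antitone-≤-ψ01 ψ-anti 0<b) ⟩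
      fromℕ k * childSum ψ 0 1 + c
        ≡⟨ cong (λ x → fromℕ k * x + c) (childSum-0-1 ψ-skew) ⟩
      fromℕ k * c + c
        ≡⟨ fromℕ-suc-* k c ⟨
      fromℕ (suc k) * c
        ∎)
    where
    K-bounds = children-bounds K (odd<double⇒< 2K+1<2^[1+k])
    0<b = ℕₚ.<-≤-trans (s-suc-pos K) (ℕₚ.m≤n+m (s (suc K)) (s K))

-- (b − a)/(a + b), written without truncated subtraction.
relDiff : ℕ → ℕ → ℚ
relDiff a b = 1ℚ - fromℕ 2 * ratio a (a ℕ.+ b)

relDiff-antitone : RatioAntitone relDiff
relDiff-antitone a b c d 0<b 0<d ad≤cb = ℚₚ.+-monoʳ-≤ 1ℚ (ℚₚ.neg-antimono-≤
  (ℚₚ.*-monoˡ-≤-nonNeg (fromℕ 2)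
    (ratio-mono {a} {a ℕ.+ b} {c} {c ℕ.+ d} 0<a+b 0<c+d (cross-≤-leftChild a b c d ad≤cb))))
  where
  0<a+b = ℕₚ.<-≤-trans 0<b (ℕₚ.m≤n+m b a)
  0<c+d = ℕₚ.<-≤-trans 0<d (ℕₚ.m≤n+m d c)

relDiff-skew : SkewSymmetric relDiff
relDiff-skew a b 0<a _ = begin
  1ℚ - fromℕ 2 * ratio b (b ℕ.+ a)  ≡⟨ cong (λ n → 1ℚ - fromℕ 2 * ratio b n) (ℕₚ.+-comm b a) ⟩
  1ℚ - fromℕ 2 * y                  ≡⟨ cong (_- fromℕ 2 * y) x+y≡1 ⟨
  (x + y) - fromℕ 2 * y             ≡⟨ solve 2 (λ x y → (x :+ y) :- con (fromℕ 2) :* y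
                                                     := :- ((x :+ y) :- con (fromℕ 2) :* x)) refl x y ⟩
  - ((x + y) - fromℕ 2 * x)         ≡⟨ cong (λ u → - (u - fromℕ 2 * x)) x+y≡1 ⟩
  - (1ℚ - fromℕ 2 * x)              ∎
  where
  open ≡-Reasoning
  open +-*-Solver
  x = ratio a (a ℕ.+ b)
  y = ratio b (a ℕ.+ b)
  x+y≡1 : x + y ≡ 1ℚ
  x+y≡1 = trans (ratio-+ a b (a ℕ.+ b)) (ratio-self (ℕₚ.<-≤-trans 0<a (ℕₚ.m≤m+n a b)))

sternSum-relDiff-bounds : ∀ k {K} → K ℕ.< 2 ^ k →
                          0ℚ ≤ sternSum relDiff K × sternSum relDiff K ≤ fromℕ k
sternSum-relDiff-bounds k K<2^k =
  let lo , hi = sternSum-bounds relDiff-antitone relDiff-skew k K<2^k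
  in  lo , subst (_ ≤_) (ℚₚ.*-identityʳ (fromℕ k)) hi

-- The defect

defect : ℕ → ℚ
defect N = ∑[ n < N ] (fromℕ 3 - fromℕ 2 * t n)

defect-pair : ∀ m → (fromℕ 3 - fromℕ 2 * t (2 ℕ.* m)) + (fromℕ 3 - fromℕ 2 * t (suc (2 ℕ.* m)))
                    ≡ (fromℕ 3 - fromℕ 2 * t m) + relDiff (s m) (s (suc m))
defect-pair m rewrite t-double m | t-double+1 m =
  solve 2 (λ x u → (con (fromℕ 3) :- con (fromℕ 2) :* x) :+ (con (fromℕ 3) :- con (fromℕ 2) :* (u :+ con 1ℚ))
                := (con (fromℕ 3) :- con (fromℕ 2) :* u) :+ (con 1ℚ :- con (fromℕ 2) :* x))
    refl (ratio (s m) (s m ℕ.+ s (suc m))) (t m)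
  where open +-*-Solver

defect-double : ∀ K → defect (2 ℕ.* K) ≡ defect K + sternSum relDiff K
defect-double K = begin
  defect (2 ℕ.* K)
    ≡⟨ ∑-pairs K _ ⟩
  ∑[ m < K ] ((fromℕ 3 - fromℕ 2 * t (2 ℕ.* m)) + (fromℕ 3 - fromℕ 2 * t (suc (2 ℕ.* m))))
    ≡⟨ ∑-cong K defect-pair ⟩
  ∑[ m < K ] ((fromℕ 3 - fromℕ 2 * t m) + relDiff (s m) (s (suc m)))
    ≡⟨ ∑-+ K _ _ ⟩
  defect K + sternSum relDiff K
    ∎
  where open ≡-Reasoning

defect-double+1 : ∀ K → defect (suc (2 ℕ.* K)) ≡ defect K + (sternSum relDiff (suc K) + fromℕ 2)
defect-double+1 K = begin
  defect (2 ℕ.* K) + (fromℕ 3 - fromℕ 2 * t (2 ℕ.* K))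
    ≡⟨ cong₂ (λ D u → D + (fromℕ 3 - fromℕ 2 * u)) (defect-double K) (t-double K) ⟩
  (defect K + sternSum relDiff K) + (fromℕ 3 - fromℕ 2 * x)
    ≡⟨ solve 3 (λ D G x → (D :+ G) :+ (con (fromℕ 3) :- con (fromℕ 2) :* x)
                        := D :+ ((G :+ (con 1ℚ :- con (fromℕ 2) :* x)) :+ con (fromℕ 2)))
         refl (defect K) (sternSum relDiff K) x ⟩
  defect K + (sternSum relDiff (suc K) + fromℕ 2)
    ∎
  where
  open ≡-Reasoning
  open +-*-Solver
  x = ratio (s K) (s K ℕ.+ s (suc K))

defect≡3N-2S : ∀ N → defect N ≡ fromℕ 3 * fromℕ N - fromℕ 2 * ∑ N t
defect≡3N-2S zero    = refl
defect≡3N-2S (suc N) = begin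
  defect N + (fromℕ 3 - fromℕ 2 * t N)
    ≡⟨ cong (_+ (fromℕ 3 - fromℕ 2 * t N)) (defect≡3N-2S N) ⟩
  (fromℕ 3 * fromℕ N - fromℕ 2 * ∑ N t) + (fromℕ 3 - fromℕ 2 * t N)
    ≡⟨ solve 3 (λ n S u → (con (fromℕ 3) :* n :- con (fromℕ 2) :* S) :+ (con (fromℕ 3) :- con (fromℕ 2) :* u)
                        := con (fromℕ 3) :* (con 1ℚ :+ n) :- con (fromℕ 2) :* (S :+ u))
         refl (fromℕ N) (∑ N t) (t N) ⟩
  fromℕ 3 * (1ℚ + fromℕ N) - fromℕ 2 * (∑ N t + t N)
    ≡⟨ cong (λ n → fromℕ 3 * n - fromℕ 2 * (∑ N t + t N)) (fromℕ-suc N) ⟨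
  fromℕ 3 * fromℕ (suc N) - fromℕ 2 * ∑ (suc N) t
    ∎
  where
  open ≡-Reasoning
  open +-*-Solver

defectBound : ℕ → ℕ
defectBound zero    = 3
defectBound (suc r) = defectBound r ℕ.+ (4 ℕ.+ r)

twice-defectBound : ∀ r → 2 ℕ.* defectBound r ≡ r ℕ.* r ℕ.+ 7 ℕ.* r ℕ.+ 6
twice-defectBound zero    = refl
twice-defectBound (suc r) = begin
  2 ℕ.* (defectBound r ℕ.+ (4 ℕ.+ r))           ≡⟨ ℕₚ.*-distribˡ-+ 2 (defectBound r) (4 ℕ.+ r) ⟩
  2 ℕ.* defectBound r ℕ.+ 2 ℕ.* (4 ℕ.+ r)       ≡⟨ cong (ℕ._+ 2 ℕ.* (4 ℕ.+ r)) (twice-defectBound r) ⟩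
  r ℕ.* r ℕ.+ 7 ℕ.* r ℕ.+ 6 ℕ.+ 2 ℕ.* (4 ℕ.+ r) ≡⟨ step r ⟩
  suc r ℕ.* suc r ℕ.+ 7 ℕ.* suc r ℕ.+ 6         ∎
  where
  open ≡-Reasoning
  step : ∀ r → r ℕ.* r ℕ.+ 7 ℕ.* r ℕ.+ 6 ℕ.+ 2 ℕ.* (4 ℕ.+ r) ≡ suc r ℕ.* suc r ℕ.+ 7 ℕ.* suc r ℕ.+ 6
  step = solve-∀

defectBound/2≡[r²+7r+6]/4 : ∀ r → fromℕ (defectBound r) * ½ ≡ + (r ℕ.* r ℕ.+ 7 ℕ.* r ℕ.+ 6) / 4
defectBound/2≡[r²+7r+6]/4 r = begin
  B * ½
    ≡⟨ solve 1 (λ B → B :* con ½ := con (fromℕ 2) :* B :* con (1/ fromℕ 4)) refl B ⟩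
  fromℕ 2 * B * 1/ fromℕ 4
    ≡⟨ cong (_* 1/ fromℕ 4) (fromℕ-* 2 (defectBound r)) ⟨
  fromℕ (2 ℕ.* defectBound r) * 1/ fromℕ 4
    ≡⟨ cong (λ n → fromℕ n * 1/ fromℕ 4) (twice-defectBound r) ⟩
  fromℕ (r ℕ.* r ℕ.+ 7 ℕ.* r ℕ.+ 6) * 1/ fromℕ 4
    ≡⟨ ratio≡*1/ (r ℕ.* r ℕ.+ 7 ℕ.* r ℕ.+ 6) 3 ⟨
  + (r ℕ.* r ℕ.+ 7 ℕ.* r ℕ.+ 6) / 4
    ∎
  where
  open ≡-Reasoning
  open +-*-Solver
  B = fromℕ (defectBound r)

defect-bounds : ∀ r N → 2 ^ r ℕ.≤ N → N ℕ.< 2 ^ suc r →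
                fromℕ 3 ≤ defect N × defect N ≤ fromℕ (defectBound r)
defect-bounds zero (suc zero) _ _ = ℚₚ.≤-refl , ℚₚ.≤-refl
defect-bounds zero (suc (suc N)) _ (s≤s (s≤s ()))
defect-bounds (suc r) N 2^[1+r]≤N N<2^[2+r] = split (parity N) 2^[1+r]≤N N<2^[2+r]
  where
  split : ∀ {N} → Parity N → 2 ^ suc r ℕ.≤ N → N ℕ.< 2 ^ suc (suc r) →
          fromℕ 3 ≤ defect N × defect N ≤ fromℕ (defectBound (suc r))
  split (even K) 2^[1+r]≤2K 2K<2^[2+r] =
    subst (fromℕ 3 ≤_) (sym (defect-double K))
      (ℚₚ.≤-trans (proj₁ K-bounds) (p≤p+q (defect K) (proj₁ G-bounds))) ,
    (begin
      defect (2 ℕ.* K)                      ≡⟨ defect-double K ⟩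
      defect K + sternSum relDiff K         ≤⟨ +-mono-≤-fromℕ (proj₂ K-bounds) (proj₂ G-bounds) ⟩
      fromℕ (defectBound r ℕ.+ suc r)
        ≤⟨ fromℕ-mono-≤ (ℕₚ.+-monoʳ-≤ (defectBound r) (ℕₚ.m≤n+m (suc r) 3)) ⟩
      fromℕ (defectBound (suc r))           ∎)
    where
    open ℚₚ.≤-Reasoning
    K<2^[1+r] = ℕₚ.*-cancelˡ-< 2 K (2 ^ suc r) 2K<2^[2+r]
    K-bounds  = defect-bounds r K (ℕₚ.*-cancelˡ-≤ 2 2^[1+r]≤2K) K<2^[1+r]
    G-bounds  = sternSum-relDiff-bounds (suc r) K<2^[1+r]
  split (odd K) 2^[1+r]≤2K+1 2K+1<2^[2+r] =
    subst (fromℕ 3 ≤_) (sym (defect-double+1 K))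
      (ℚₚ.≤-trans (proj₁ K-bounds) (p≤p+q (defect K) (ℚₚ.+-mono-≤ (proj₁ G-bounds) (fromℕ-mono-≤ z≤n)))) ,
    (begin
      defect (suc (2 ℕ.* K))                               ≡⟨ defect-double+1 K ⟩
      defect K + (sternSum relDiff (suc K) + fromℕ 2)      ≤⟨ +-mono-≤-fromℕ (proj₂ K-bounds)
                                                                (+-mono-≤-fromℕ (proj₂ G-bounds) ℚₚ.≤-refl) ⟩
      fromℕ (defectBound r ℕ.+ (suc (suc r) ℕ.+ 2))
        ≡⟨ cong (fromℕ ∘ (defectBound r ℕ.+_)) (ℕₚ.+-comm (suc (suc r)) 2) ⟩
      fromℕ (defectBound (suc r))                          ∎)
    where
    open ℚₚ.≤-Reasoning
    K-bounds = defect-bounds r K (double≤odd⇒≤ 2^[1+r]≤2K+1) (odd<double⇒< 2K+1<2^[2+r])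
    G-bounds = sternSum-relDiff-bounds (suc (suc r)) (ℕₚ.≤-<-trans (s≤s (ℕₚ.m≤m+n K _)) 2K+1<2^[2+r])

sumT≡[3N-defect]/2 : ∀ N → sumT N ≡ (fromℕ 3 * fromℕ N - defect N) * ½
sumT≡[3N-defect]/2 N = begin
  sumT N                          ≡⟨ sumT≡∑ N ⟩
  ∑ N t
    ≡⟨ solve 2 (λ X S → S := (X :- (X :- con (fromℕ 2) :* S)) :* con ½) refl X (∑ N t) ⟩
  (X - (X - fromℕ 2 * ∑ N t)) * ½ ≡⟨ cong (λ d → (X - d) * ½) (defect≡3N-2S N) ⟨
  (X - defect N) * ½              ∎
  where
  open ≡-Reasoning
  open +-*-Solver
  X = fromℕ 3 * fromℕ N

[3N-x]/2≡3N/2-x/2 : ∀ N x → (fromℕ 3 * fromℕ N - x) * ½ ≡ + (3 ℕ.* N) / 2 - x * ½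
[3N-x]/2≡3N/2-x/2 N x = begin
  (X - x) * ½                  ≡⟨ solve 2 (λ X x → (X :- x) :* con ½ := X :* con ½ :- x :* con ½) refl X x ⟩
  X * ½ - x * ½                ≡⟨ cong (λ y → y * ½ - x * ½) (fromℕ-* 3 N) ⟨
  fromℕ (3 ℕ.* N) * ½ - x * ½  ≡⟨ cong (_- x * ½) (ratio≡*1/ (3 ℕ.* N) 1) ⟨
  + (3 ℕ.* N) / 2 - x * ½      ∎
  where
  open ≡-Reasoning
  open +-*-Solver
  X = fromℕ 3 * fromℕ N

theorem3p3 : (N r : ℕ) → 2 ^ r ℕ.≤ N → N ℕ.< 2 ^ (r ℕ.+ 1) →
    (((+ (3 ℕ.* N)) / 2) - ((+ (r ℕ.* r ℕ.+ 7 ℕ.* r ℕ.+ 6)) / 4) ≤ sumT N)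
    Data.Product.× (sumT N < ((+ (3 ℕ.* N)) / 2) - ((+ 1) / 2))
theorem3p3 N r 2^r≤N N<2^[r+1] = lower , upper
  where
  open ℚₚ.≤-Reasoning
  X = fromℕ 3 * fromℕ N
  D = defect N
  B = fromℕ (defectBound r)
  D-bounds = defect-bounds r N 2^r≤N (subst (N ℕ.<_) (cong (2 ^_) (ℕₚ.+-comm r 1)) N<2^[r+1])

  lower : + (3 ℕ.* N) / 2 - + (r ℕ.* r ℕ.+ 7 ℕ.* r ℕ.+ 6) / 4 ≤ sumT N
  lower = begin
    + (3 ℕ.* N) / 2 - + (r ℕ.* r ℕ.+ 7 ℕ.* r ℕ.+ 6) / 4
      ≡⟨ cong (_-_ (+ (3 ℕ.* N) / 2)) (defectBound/2≡[r²+7r+6]/4 r) ⟨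
    + (3 ℕ.* N) / 2 - B * ½
      ≡⟨ [3N-x]/2≡3N/2-x/2 N B ⟨
    (X - B) * ½
      ≤⟨ ℚₚ.*-monoʳ-≤-nonNeg ½ (ℚₚ.+-monoʳ-≤ X (ℚₚ.neg-antimono-≤ (proj₂ D-bounds))) ⟩
    (X - D) * ½
      ≡⟨ sumT≡[3N-defect]/2 N ⟨
    sumT N
      ∎

  upper : sumT N < + (3 ℕ.* N) / 2 - + 1 / 2
  upper = begin-strict
    sumT N                    ≡⟨ sumT≡[3N-defect]/2 N ⟩
    (X - D) * ½               <⟨ ℚₚ.*-monoˡ-<-pos ½ (ℚₚ.+-monoʳ-< X (ℚₚ.neg-antimono-< 1<D)) ⟩
    (X - 1ℚ) * ½              ≡⟨ [3N-x]/2≡3N/2-x/2 N 1ℚ ⟩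
    + (3 ℕ.* N) / 2 - 1ℚ * ½  ≡⟨ cong (_-_ (+ (3 ℕ.* N) / 2)) (ℚₚ.*-identityˡ ½) ⟩
    + (3 ℕ.* N) / 2 - + 1 / 2 ∎
    where
    1<D : 1ℚ < D
    1<D = ℚₚ.<-≤-trans (*<* (ℤ.+<+ (s≤s (s≤s z≤n)))) (proj₁ D-bounds)
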